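{- For every integer $n \geq 6$, $s(n)$ equals the number of partitions of $n$ into distinct parts $p_1 > p_2 > \cdots > p_k$ with $k \geq 3$ and $$p_1 = p_2 + 1 = p_3 + 2 > p_4 > \cdots > p_k > 1,$$ i.e. the number of strict partitions of $n$ with at least three parts, the three largest parts consecutive integers, and the smallest part at least $2$.
   Context: For $n \geq 0$ let $q(n)$ be the number of partitions of $n$ into distinct parts (strict partitions), with $q(0)=1$, and set $q(-1)=q(-2)=0$. The butterfly sequence is $s(n) = q(n) - 2q(n-1) + q(n-2)$ for $n \geq 0$, i.e. the second difference sequence of $q$. -}

module Defs where

open import Data.Nat using (ℕ; zero; suc; _+_; _∸_; _≤?_; _<?_; _≟_)
open import Data.List using (List; []; _∷_; _++_; map; length; filter)
open import Data.Bool using (Bool; true; false)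
open import Data.Integer using (ℤ; +_; _-_) renaming (_+_ to _+ℤ_; _*_ to _*ℤ_)
open import Relation.Nullary using (Dec; yes; no)
open import Relation.Unary using (Pred; Decidable)
open import Relation.Nullary.Decidable using (_×-dec_)
open import Data.Product using (_×_)
open import Data.Unit using (⊤)
open import Data.Empty using (⊥)
open import Relation.Binary.PropositionalEquality using (_≡_)
open import Level using (0ℓ)

-- A strict partition is represented as a list of parts in strictly
-- decreasing order, all parts positive.
-- strictPartsBounded m n : all strict partitions of n with every part ≤ m
-- (each listed exactly once, largest part first).
strictPartsBounded : ℕ → ℕ → List (List ℕ)
strictPartsBounded zero zero = [] ∷ []
strictPartsBounded zero (suc n) = []
strictPartsBounded (suc m) n with suc m ≤? n
... | yes _ = strictPartsBounded m n ++ map (suc m ∷_) (strictPartsBounded m (n ∸ suc m))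
... | no _  = strictPartsBounded m n

strictParts : ℕ → List (List ℕ)
strictParts n = strictPartsBounded n n

q : ℕ → ℕ
q n = length (strictParts n)

qz : ℕ → ℤ
qz n = + q n

-- butterfly sequence s(n) = q(n) - 2 q(n-1) + q(n-2), with q(-1)=q(-2)=0
s : ℕ → ℤ
s zero = qz 0
s (suc zero) = qz 1 - (+ 2) *ℤ qz 0
s (suc (suc n)) = (qz (suc (suc n)) - (+ 2) *ℤ qz (suc n)) +ℤ qz n

-- last element of a list (Nothing-free: default 0 for empty list)
lastPart : List ℕ → ℕ
lastPart [] = 0
lastPart (x ∷ []) = x
lastPart (x ∷ y ∷ xs) = lastPart (y ∷ xs)

Special : List ℕ → Set
Special [] = ⊥
Special (_ ∷ []) = ⊥
Special (_ ∷ _ ∷ []) = ⊥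
Special (a ∷ b ∷ c ∷ rest) = (a ≡ b + 1) × (b ≡ c + 1) × (1 Data.Nat.< lastPart (a ∷ b ∷ c ∷ rest))

special? : (p : List ℕ) → Dec (Special p)
special? [] = no λ ()
special? (_ ∷ []) = no λ ()
special? (_ ∷ _ ∷ []) = no λ ()
special? (a ∷ b ∷ c ∷ rest) = (a ≟ b + 1) ×-dec ((b ≟ c + 1) ×-dec (1 <? lastPart (a ∷ b ∷ c ∷ rest)))

-- Read everything through generating functions, kept as coefficient sequences ℕ → ℤ in which
-- multiplication by x^k is a shift. With P_m = ∏_{i=2}^{m} (1 + x^i), strict partitions with parts
-- ≤ m have generating function (1 + x) P_m, so for n ≤ m, s(n) is the coefficient of x^n in
-- (1 - x)(1 - x²) P_m. Two telescoping identities, with J_j = Σ_{i=1}^{j} x^{2i+3} P_i,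
--   (1 - x) P_{j+2} + x^{j+3} P_{j+1} = 1 - x + x² + J_j,
--   (1 - x²) J_j + x^{2j+5} P_j = x⁵ + S_{j+2},
-- where S_m counts the special partitions with parts ≤ m, identify that product with S_m in every
-- degree 6 ≤ n ≤ m. The second one holds because removing the three largest parts k+2, k+1, k of
-- a special partition (where k ≥ 2) leaves an arbitrary strict partition into parts in [2, k - 1].

module Submission where

open import Defs
open import Data.Nat as ℕ using (ℕ; zero; suc; _≤_; _<_; _≤?_; _<?_; z≤n; s≤s; _∸_)
import Data.Nat.Properties as ℕₚ
open import Data.Integer using (ℤ; +_; 0ℤ; 1ℤ; _+_; _-_; _*_)
import Data.Integer.Properties as ℤₚ
open import Data.Integer.Tactic.RingSolver using (solve-∀)
open import Data.List using (List; []; _∷_; _++_; map; length; filter)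
open import Data.List.Properties using (length-++; filter-++; filter-none; filter-all; filter-≐)
open import Data.List.Relation.Unary.All as All using (All; []; _∷_)
import Data.List.Relation.Unary.All.Properties as Allₚ
open import Data.Product using (_,_; proj₂)
open import Data.Bool using (true; false)
open import Data.Unit using (tt)
open import Function using (_∘_)
open import Level using (0ℓ)
open import Relation.Nullary using (¬_; does; yes; no)
open import Relation.Unary using (Pred; Decidable; _≐_)
open import Relation.Unary.Properties using (U?)
open import Relation.Binary.PropositionalEquality
  using (_≡_; _≗_; refl; sym; trans; cong; cong₂; subst; module ≡-Reasoning)

Series : Set
Series = ℕ → ℤ

one : Series
one zero = 1ℤ
one (suc _) = 0ℤ

shift : ℕ → Series → Series
shift zero f n = f n
shift (suc k) f zero = 0ℤ
shift (suc k) f (suc n) = shift k f n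

shift-below : ∀ k f {n} → n < k → shift k f n ≡ 0ℤ
shift-below (suc k) f {zero} _ = refl
shift-below (suc k) f {suc n} (s≤s n<k) = shift-below k f n<k

shift-above : ∀ k f {n} → k ≤ n → shift k f n ≡ f (n ∸ k)
shift-above zero f _ = refl
shift-above (suc k) f (s≤s k≤n) = shift-above k f k≤n

shift-cong : ∀ k {f g : Series} → f ≗ g → shift k f ≗ shift k g
shift-cong zero f≗g n = f≗g n
shift-cong (suc k) f≗g zero = refl
shift-cong (suc k) f≗g (suc n) = shift-cong k f≗g n

shift-null : ∀ k {f : Series} → (∀ n → f n ≡ 0ℤ) → ∀ n → shift k f n ≡ 0ℤ
shift-null zero f≡0 n = f≡0 n
shift-null (suc k) f≡0 zero = refl
shift-null (suc k) f≡0 (suc n) = shift-null k f≡0 n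

shift-+ : ∀ k (f g : Series) n → shift k (λ i → f i + g i) n ≡ shift k f n + shift k g n
shift-+ zero f g n = refl
shift-+ (suc k) f g zero = refl
shift-+ (suc k) f g (suc n) = shift-+ k f g n

shift-shift : ∀ k l (f : Series) n → shift k (shift l f) n ≡ shift (k ℕ.+ l) f n
shift-shift zero l f n = refl
shift-shift (suc k) l f zero = refl
shift-shift (suc k) l f (suc n) = shift-shift k l f n

shift-comm : ∀ k l (f : Series) n → shift k (shift l f) n ≡ shift l (shift k f) n
shift-comm k l f n = begin
  shift k (shift l f) n  ≡⟨ shift-shift k l f n ⟩
  shift (k ℕ.+ l) f n    ≡⟨ cong (λ i → shift i f n) (ℕₚ.+-comm k l) ⟩
  shift (l ℕ.+ k) f n    ≡⟨ shift-shift l k f n ⟨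
  shift l (shift k f) n  ∎
  where open ≡-Reasoning

count : {P : Pred (List ℕ) 0ℓ} → Decidable P → ℕ → Series
count P? m n = + length (filter P? (strictPartsBounded m n))

length-filter-map : ∀ {A B : Set} {P : Pred B 0ℓ} (P? : Decidable P) (f : A → B) xs →
                    length (filter P? (map f xs)) ≡ length (filter (P? ∘ f) xs)
length-filter-map P? f [] = refl
length-filter-map P? f (x ∷ xs) with does (P? (f x))
... | true  = cong suc (length-filter-map P? f xs)
... | false = length-filter-map P? f xs

count-suc : ∀ {P} (P? : Decidable P) m n →
            count P? (suc m) n ≡ count P? m n + shift (suc m) (count (P? ∘ (suc m ∷_)) m) n
count-suc P? m n with suc m ≤? n
... | yes m<n = begin
  + length (filter P? (small ++ map (suc m ∷_) large))
    ≡⟨ cong (+_ ∘ length) (filter-++ P? small _) ⟩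
  + length (filter P? small ++ filter P? (map (suc m ∷_) large))
    ≡⟨ cong +_ (length-++ (filter P? small)) ⟩
  + (length (filter P? small) ℕ.+ length (filter P? (map (suc m ∷_) large)))
    ≡⟨ ℤₚ.pos-+ (length (filter P? small)) _ ⟩
  count P? m n + + length (filter P? (map (suc m ∷_) large))
    ≡⟨ cong (λ k → count P? m n + + k) (length-filter-map P? (suc m ∷_) large) ⟩
  count P? m n + count (P? ∘ (suc m ∷_)) m (n ∸ suc m)
    ≡⟨ cong (_+_ (count P? m n)) (sym (shift-above (suc m) _ m<n)) ⟩
  count P? m n + shift (suc m) (count (P? ∘ (suc m ∷_)) m) n ∎
  where
  open ≡-Reasoning
  small = strictPartsBounded m n
  large = strictPartsBounded m (n ∸ suc m)
... | no m≮n = sym (trans (cong (_+_ (count P? m n)) (shift-below (suc m) _ (ℕₚ.≰⇒> m≮n)))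
                          (ℤₚ.+-identityʳ _))

strictPartsBounded-≤ : ∀ m n → All (All (_≤ m)) (strictPartsBounded m n)
strictPartsBounded-≤ zero zero = [] ∷ []
strictPartsBounded-≤ zero (suc n) = []
strictPartsBounded-≤ (suc m) n with suc m ≤? n
... | yes _ = Allₚ.++⁺ (All.map weaken (strictPartsBounded-≤ m n))
                      (Allₚ.map⁺ (All.map (λ p≤m → ℕₚ.≤-refl ∷ weaken p≤m)
                                          (strictPartsBounded-≤ m (n ∸ suc m))))
  where weaken = All.map ℕₚ.m≤n⇒m≤1+n
... | no _  = All.map (All.map ℕₚ.m≤n⇒m≤1+n) (strictPartsBounded-≤ m n)

count-none : ∀ {P} (P? : Decidable P) {m} → (∀ {p} → P p → ¬ All (_≤ m) p) →
             ∀ n → count P? m n ≡ 0ℤ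
count-none P? tooLarge n =
  cong (+_ ∘ length)
       (filter-none P? (All.map (λ p≤m Pp → tooLarge Pp p≤m) (strictPartsBounded-≤ _ n)))

count-largest : ∀ {P} (P? : Decidable P) {m} → (∀ {p} → P p → ¬ All (_≤ m) p) →
                ∀ n → count P? (suc m) n ≡ shift (suc m) (count (P? ∘ (suc m ∷_)) m) n
count-largest P? {m} tooLarge n =
  trans (count-suc P? m n)
        (trans (cong (_+ shift (suc m) (count (P? ∘ (suc m ∷_)) m) n) (count-none P? tooLarge n))
               (ℤₚ.+-identityˡ _))

count-stable : ∀ {P} (P? : Decidable P) {m n} → n ≤ m → count P? (suc m) n ≡ count P? m n
count-stable P? {m} {n} n≤m =
  trans (count-suc P? m n) (trans (cong (_+_ (count P? m n)) (shift-below (suc m) _ (s≤s n≤m)))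
                                  (ℤₚ.+-identityʳ _))

count-≐ : ∀ {P Q} (P? : Decidable P) (Q? : Decidable Q) → P ≐ Q →
          ∀ m n → count P? m n ≡ count Q? m n
count-≐ P? Q? P≐Q m n = cong (+_ ∘ length) (filter-≐ P? Q? P≐Q (strictPartsBounded m n))

q-as-count : ∀ d k → qz k ≡ count U? (d ℕ.+ k) k
q-as-count zero k =
  cong (+_ ∘ length) (sym (filter-all U? (All.universal (λ _ → tt) (strictParts k))))
q-as-count (suc d) k = trans (q-as-count d k) (sym (count-stable U? (ℕₚ.m≤n+m k d)))

-- ∏_{i=2}^{m} (1 + x^i), the generating function of strict partitions with parts in [2, m]
noOnes : ℕ → Series
noOnes zero = one
noOnes (suc zero) = one
noOnes (suc (suc m)) n = noOnes (suc m) n + shift (suc (suc m)) (noOnes (suc m)) n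

count-all-noOnes : ∀ j n → count U? (suc j) n ≡ noOnes (suc j) n + shift 1 (noOnes (suc j)) n
count-all-noOnes zero n =
  trans (count-suc U? 0 n) (cong₂ _+_ (count-U?-0 n) (shift-cong 1 count-U?-0 n))
  where
  count-U?-0 : ∀ n → count U? 0 n ≡ one n
  count-U?-0 zero = refl
  count-U?-0 (suc n) = refl
count-all-noOnes (suc j) n = begin
  count U? (2 ℕ.+ j) n
    ≡⟨ count-suc U? (suc j) n ⟩
  count U? (suc j) n + shift (2 ℕ.+ j) (count U? (suc j)) n
    ≡⟨ cong₂ _+_ (count-all-noOnes j n)
                 (trans (shift-cong (2 ℕ.+ j) (count-all-noOnes j) n)
                        (shift-+ (2 ℕ.+ j) P (shift 1 P) n)) ⟩
  (P n + shift 1 P n) + (shift (2 ℕ.+ j) P n + shift (2 ℕ.+ j) (shift 1 P) n)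
    ≡⟨ cong (λ z → (P n + shift 1 P n) + (shift (2 ℕ.+ j) P n + z)) (shift-comm (2 ℕ.+ j) 1 P n) ⟩
  (P n + shift 1 P n) + (shift (2 ℕ.+ j) P n + shift 1 (shift (2 ℕ.+ j) P) n)
    ≡⟨ interchange (P n) (shift 1 P n) (shift (2 ℕ.+ j) P n) (shift 1 (shift (2 ℕ.+ j) P) n) ⟩
  (P n + shift (2 ℕ.+ j) P n) + (shift 1 P n + shift 1 (shift (2 ℕ.+ j) P) n)
    ≡⟨ cong (_+_ (noOnes (2 ℕ.+ j) n)) (shift-+ 1 P (shift (2 ℕ.+ j) P) n) ⟨
  noOnes (2 ℕ.+ j) n + shift 1 (noOnes (2 ℕ.+ j)) n ∎
  where
  open ≡-Reasoning
  P = noOnes (suc j)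
  interchange : ∀ a b c d → (a + b) + (c + d) ≡ (a + c) + (b + d)
  interchange = solve-∀

endsAboveOne? : (c : ℕ) → Decidable (λ r → 1 < lastPart (c ∷ r))
endsAboveOne? c r = 1 <? lastPart (c ∷ r)

-- Prefixing c (rather than testing the tail alone) makes the empty tail count exactly when c ≥ 2.
tails : ℕ → ℕ → Series
tails c = count (endsAboveOne? c)

tails≗noOnes : ∀ {c} → 2 ≤ c → ∀ j n → tails c j n ≡ noOnes j n
noOnes-suc : ∀ j n → noOnes (suc j) n ≡ noOnes j n + shift (suc j) (tails (suc j) j) n

tails≗noOnes (s≤s (s≤s _)) zero zero = refl
tails≗noOnes (s≤s (s≤s _)) zero (suc n) = refl
tails≗noOnes {c} 2≤c (suc j) n = begin
  tails c (suc j) n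
    ≡⟨ count-suc (endsAboveOne? c) j n ⟩
  tails c j n + shift (suc j) (tails (suc j) j) n
    ≡⟨ cong (_+ shift (suc j) (tails (suc j) j) n) (tails≗noOnes 2≤c j n) ⟩
  noOnes j n + shift (suc j) (tails (suc j) j) n
    ≡⟨ noOnes-suc j n ⟨
  noOnes (suc j) n ∎
  where open ≡-Reasoning

noOnes-suc zero n =
  sym (trans (cong (_+_ (one n)) (shift-null 1 noPartAfterOne n)) (ℤₚ.+-identityʳ _))
  where
  noPartAfterOne : ∀ n → tails 1 0 n ≡ 0ℤ
  noPartAfterOne zero = refl
  noPartAfterOne (suc n) = refl
noOnes-suc (suc j) n =
  cong (_+_ (noOnes (suc j) n))
       (shift-cong (2 ℕ.+ j) (λ k → sym (tails≗noOnes (s≤s (s≤s z≤n)) (suc j) k)) n)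

count-special-2 : ∀ n → count special? 2 n ≡ 0ℤ
count-special-2 zero = refl
count-special-2 (suc zero) = refl
count-special-2 (suc (suc zero)) = refl
count-special-2 (suc (suc (suc zero))) = refl
count-special-2 (suc (suc (suc (suc n)))) = refl

newSpecials : ℕ → Series
newSpecials j = shift (3 ℕ.+ j) (shift (2 ℕ.+ j) (shift (1 ℕ.+ j) (tails (suc j) j)))

count-special-suc : ∀ j n → count special? (3 ℕ.+ j) n ≡ count special? (2 ℕ.+ j) n + newSpecials j n
count-special-suc j n = begin
  count special? (3 ℕ.+ j) n
    ≡⟨ count-suc special? (2 ℕ.+ j) n ⟩
  count special? (2 ℕ.+ j) n + shift (3 ℕ.+ j) (count (special? ∘ (3 ℕ.+ j ∷_)) (2 ℕ.+ j)) n
    ≡⟨ cong (_+_ (count special? (2 ℕ.+ j) n)) (shift-cong (3 ℕ.+ j) peelSecond n) ⟩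
  count special? (2 ℕ.+ j) n + newSpecials j n ∎
  where
  open ≡-Reasoning
  ≡+1⇒≰ : ∀ {m b} → suc (suc m) ≡ b ℕ.+ 1 → ¬ b ≤ m
  ≡+1⇒≰ {m} {b} eq b≤m = ℕₚ.1+n≰n (subst (_≤ suc m) (trans (ℕₚ.+-comm 1 b) (sym eq)) (s≤s b≤m))
  secondTooLarge : ∀ {p} → Special (3 ℕ.+ j ∷ p) → ¬ All (_≤ suc j) p
  secondTooLarge {_ ∷ _ ∷ _} (a≡b+1 , _) (b≤1+j ∷ _) = ≡+1⇒≰ a≡b+1 b≤1+j
  thirdTooLarge : ∀ {p} → Special (3 ℕ.+ j ∷ 2 ℕ.+ j ∷ p) → ¬ All (_≤ j) p
  thirdTooLarge {_ ∷ _} (_ , b≡c+1 , _) (c≤j ∷ _) = ≡+1⇒≰ b≡c+1 c≤j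
  tailEndsAboveOne : (λ r → Special (3 ℕ.+ j ∷ 2 ℕ.+ j ∷ 1 ℕ.+ j ∷ r)) ≐
                     (λ r → 1 < lastPart (suc j ∷ r))
  tailEndsAboveOne = (λ special → proj₂ (proj₂ special)) ,
                     (λ 1<last → ℕₚ.+-comm 1 _ , ℕₚ.+-comm 1 _ , 1<last)
  peelThird : ∀ k → count (special? ∘ (3 ℕ.+ j ∷_) ∘ (2 ℕ.+ j ∷_)) (1 ℕ.+ j) k ≡
                    shift (1 ℕ.+ j) (tails (suc j) j) k
  peelThird k = trans (count-largest _ thirdTooLarge k)
                      (shift-cong (1 ℕ.+ j) (count-≐ _ (endsAboveOne? (suc j)) tailEndsAboveOne j) k)
  peelSecond : ∀ k → count (special? ∘ (3 ℕ.+ j ∷_)) (2 ℕ.+ j) k ≡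
                     shift (2 ℕ.+ j) (shift (1 ℕ.+ j) (tails (suc j) j)) k
  peelSecond k = trans (count-largest _ secondTooLarge k) (shift-cong (2 ℕ.+ j) peelThird k)

consecutivePairs : ℕ → Series
consecutivePairs zero _ = 0ℤ
consecutivePairs (suc j) n = consecutivePairs j n + shift (3 ℕ.+ j) (shift (2 ℕ.+ j) (noOnes (suc j))) n

noOnes-telescope : ∀ j n →
  noOnes (2 ℕ.+ j) n - shift 1 (noOnes (2 ℕ.+ j)) n + shift (3 ℕ.+ j) (noOnes (1 ℕ.+ j)) n ≡
  (one n - shift 1 one n + shift 2 one n) + consecutivePairs j n
noOnes-telescope zero zero = refl
noOnes-telescope zero (suc zero) = refl
noOnes-telescope zero (suc (suc zero)) = refl
noOnes-telescope zero (suc (suc (suc zero))) = refl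
noOnes-telescope zero (suc (suc (suc (suc n)))) = refl
noOnes-telescope (suc j) n = begin
  (A n + shift (3 ℕ.+ j) A n) - shift 1 (λ i → A i + shift (3 ℕ.+ j) A i) n + shift (4 ℕ.+ j) A n
    ≡⟨ cong (λ z → (A n + shift (3 ℕ.+ j) A n) - z + shift (4 ℕ.+ j) A n)
            (trans (shift-+ 1 A (shift (3 ℕ.+ j) A) n)
                   (cong (_+_ (shift 1 A n)) (shift-shift 1 (3 ℕ.+ j) A n))) ⟩
  (A n + shift (3 ℕ.+ j) A n) - (shift 1 A n + shift (4 ℕ.+ j) A n) + shift (4 ℕ.+ j) A n
    ≡⟨ cancel (A n) (shift (3 ℕ.+ j) A n) (shift 1 A n) (shift (4 ℕ.+ j) A n) ⟩
  A n - shift 1 A n + shift (3 ℕ.+ j) A n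
    ≡⟨ cong (_+_ (A n - shift 1 A n)) (shift-+ (3 ℕ.+ j) B (shift (2 ℕ.+ j) B) n) ⟩
  A n - shift 1 A n + (shift (3 ℕ.+ j) B n + shift (3 ℕ.+ j) (shift (2 ℕ.+ j) B) n)
    ≡⟨ ℤₚ.+-assoc (A n - shift 1 A n) (shift (3 ℕ.+ j) B n) _ ⟨
  A n - shift 1 A n + shift (3 ℕ.+ j) B n + shift (3 ℕ.+ j) (shift (2 ℕ.+ j) B) n
    ≡⟨ cong (_+ shift (3 ℕ.+ j) (shift (2 ℕ.+ j) B) n) (noOnes-telescope j n) ⟩
  (one n - shift 1 one n + shift 2 one n) + consecutivePairs j n + shift (3 ℕ.+ j) (shift (2 ℕ.+ j) B) n
    ≡⟨ ℤₚ.+-assoc (one n - shift 1 one n + shift 2 one n) (consecutivePairs j n) _ ⟩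
  (one n - shift 1 one n + shift 2 one n) + consecutivePairs (suc j) n ∎
  where
  open ≡-Reasoning
  A = noOnes (2 ℕ.+ j)
  B = noOnes (1 ℕ.+ j)
  cancel : ∀ a b c d → (a + b) - (c + d) + d ≡ a - c + b
  cancel = solve-∀

consecutivePairs-telescope : ∀ j n →
  consecutivePairs j n - shift 2 (consecutivePairs j) n
    + shift 2 (shift (2 ℕ.+ j) (shift (1 ℕ.+ j) (noOnes j))) n ≡
  shift 5 one n + count special? (2 ℕ.+ j) n
consecutivePairs-telescope zero n = begin
  0ℤ - shift 2 (λ _ → 0ℤ) n + shift 2 (shift 2 (shift 1 one)) n
    ≡⟨ cong₂ (λ a b → 0ℤ - a + b) (shift-null 2 (λ _ → refl) n)
                                   (trans (shift-shift 2 2 _ n) (shift-shift 4 1 one n)) ⟩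
  0ℤ - 0ℤ + shift 5 one n
    ≡⟨ ℤₚ.+-identityˡ _ ⟩
  shift 5 one n
    ≡⟨ trans (cong (_+_ (shift 5 one n)) (count-special-2 n)) (ℤₚ.+-identityʳ _) ⟨
  shift 5 one n + count special? 2 n ∎
  where open ≡-Reasoning
consecutivePairs-telescope (suc j) n = begin
  (J n + K n) - shift 2 (λ i → J i + K i) n + shift 2 K n
    ≡⟨ cong (λ z → (J n + K n) - z + shift 2 K n) (shift-+ 2 J K n) ⟩
  (J n + K n) - (shift 2 J n + shift 2 K n) + shift 2 K n
    ≡⟨ cancel (J n) (K n) (shift 2 J n) (shift 2 K n) ⟩
  J n - shift 2 J n + K n
    ≡⟨ cong (_+_ (J n - shift 2 J n)) K-split ⟩
  J n - shift 2 J n + (shift 2 (shift (2 ℕ.+ j) (shift (1 ℕ.+ j) P)) n + newSpecials j n)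
    ≡⟨ ℤₚ.+-assoc (J n - shift 2 J n) _ (newSpecials j n) ⟨
  J n - shift 2 J n + shift 2 (shift (2 ℕ.+ j) (shift (1 ℕ.+ j) P)) n + newSpecials j n
    ≡⟨ cong (_+ newSpecials j n) (consecutivePairs-telescope j n) ⟩
  shift 5 one n + count special? (2 ℕ.+ j) n + newSpecials j n
    ≡⟨ ℤₚ.+-assoc (shift 5 one n) (count special? (2 ℕ.+ j) n) (newSpecials j n) ⟩
  shift 5 one n + (count special? (2 ℕ.+ j) n + newSpecials j n)
    ≡⟨ cong (_+_ (shift 5 one n)) (count-special-suc j n) ⟨
  shift 5 one n + count special? (3 ℕ.+ j) n ∎
  where
  open ≡-Reasoning
  J = consecutivePairs j
  P = noOnes j
  K : Series
  K = shift (3 ℕ.+ j) (shift (2 ℕ.+ j) (noOnes (suc j)))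
  cancel : ∀ a b c d → (a + b) - (c + d) + d ≡ a - c + b
  cancel = solve-∀
  regroup : ∀ f → shift (3 ℕ.+ j) (shift (2 ℕ.+ j) f) n ≡
                   shift 2 (shift (2 ℕ.+ j) (shift (1 ℕ.+ j) f)) n
  regroup f = begin
    shift (3 ℕ.+ j) (shift (2 ℕ.+ j) f) n     ≡⟨ shift-shift (3 ℕ.+ j) (2 ℕ.+ j) f n ⟩
    shift ((3 ℕ.+ j) ℕ.+ (2 ℕ.+ j)) f n       ≡⟨ cong (λ k → shift (3 ℕ.+ k) f n) (ℕₚ.+-suc j (suc j)) ⟩
    shift ((4 ℕ.+ j) ℕ.+ (1 ℕ.+ j)) f n       ≡⟨ shift-shift (4 ℕ.+ j) (1 ℕ.+ j) f n ⟨
    shift (4 ℕ.+ j) (shift (1 ℕ.+ j) f) n     ≡⟨ shift-shift 2 (2 ℕ.+ j) (shift (1 ℕ.+ j) f) n ⟨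
    shift 2 (shift (2 ℕ.+ j) (shift (1 ℕ.+ j) f)) n ∎
  K-split : K n ≡ shift 2 (shift (2 ℕ.+ j) (shift (1 ℕ.+ j) P)) n + newSpecials j n
  K-split = begin
    K n
      ≡⟨ shift-cong (3 ℕ.+ j) (shift-cong (2 ℕ.+ j) (noOnes-suc j)) n ⟩
    shift (3 ℕ.+ j) (shift (2 ℕ.+ j) (λ i → P i + shift (1 ℕ.+ j) W i)) n
      ≡⟨ shift-cong (3 ℕ.+ j) (shift-+ (2 ℕ.+ j) P (shift (1 ℕ.+ j) W)) n ⟩
    shift (3 ℕ.+ j) (λ i → shift (2 ℕ.+ j) P i + shift (2 ℕ.+ j) (shift (1 ℕ.+ j) W) i) n
      ≡⟨ shift-+ (3 ℕ.+ j) (shift (2 ℕ.+ j) P) _ n ⟩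
    shift (3 ℕ.+ j) (shift (2 ℕ.+ j) P) n + newSpecials j n
      ≡⟨ cong (_+ newSpecials j n) (regroup P) ⟩
    shift 2 (shift (2 ℕ.+ j) (shift (1 ℕ.+ j) P)) n + newSpecials j n ∎
    where W = tails (suc j) j

s-via-noOnes : ∀ m → let P = noOnes (3 ℕ.+ m) in
  s (3 ℕ.+ m) ≡ (P (3 ℕ.+ m) - shift 1 P (3 ℕ.+ m)) - (P (1 ℕ.+ m) - shift 1 P (1 ℕ.+ m))
s-via-noOnes m = begin
  secondDifference (qz k₃) (qz k₂) (qz k₁)
    ≡⟨ secondDifference-cong (q-as-count 0 k₃) (q-as-count 1 k₂) (q-as-count 2 k₁) ⟩
  secondDifference (T k₃) (T k₂) (T k₁)
    ≡⟨ secondDifference-cong (count-all-noOnes k₂ k₃) (count-all-noOnes k₂ k₂) (count-all-noOnes k₂ k₁) ⟩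
  secondDifference (P k₃ + P k₂) (P k₂ + P k₁) (P k₁ + shift 1 P k₁)
    ≡⟨ factor (P k₃) (P k₂) (P k₁) (shift 1 P k₁) ⟩
  (P k₃ - P k₂) - (P k₁ - shift 1 P k₁) ∎
  where
  open ≡-Reasoning
  k₁ = 1 ℕ.+ m
  k₂ = 2 ℕ.+ m
  k₃ = 3 ℕ.+ m
  T = count U? k₃
  P = noOnes k₃
  secondDifference : ℤ → ℤ → ℤ → ℤ
  secondDifference a b c = a - + 2 * b + c
  secondDifference-cong : ∀ {a a′ b b′ c c′} → a ≡ a′ → b ≡ b′ → c ≡ c′ →
                          secondDifference a b c ≡ secondDifference a′ b′ c′
  secondDifference-cong refl refl refl = refl
  -- (1 - x)² (1 + x) = (1 - x) (1 - x²)
  factor : ∀ a b c d → (a + b) - + 2 * (b + c) + (c + d) ≡ (a - b) - (c - d)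
  factor = solve-∀

noOnes-diff : ∀ j n → 3 ≤ n → n ≤ 2 ℕ.+ j →
              noOnes (2 ℕ.+ j) n - shift 1 (noOnes (2 ℕ.+ j)) n ≡ consecutivePairs j n
noOnes-diff j n (s≤s (s≤s (s≤s z≤n))) n≤2+j = begin
  D ≡⟨ ℤₚ.+-identityʳ D ⟨
  D + 0ℤ ≡⟨ cong (_+_ D) (shift-below (3 ℕ.+ j) (noOnes (1 ℕ.+ j)) (s≤s n≤2+j)) ⟨
  D + shift (3 ℕ.+ j) (noOnes (1 ℕ.+ j)) n ≡⟨ noOnes-telescope j n ⟩
  0ℤ + consecutivePairs j n ≡⟨ ℤₚ.+-identityˡ _ ⟩
  consecutivePairs j n ∎
  where
  open ≡-Reasoning
  D = noOnes (2 ℕ.+ j) n - shift 1 (noOnes (2 ℕ.+ j)) n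

consecutivePairs-diff : ∀ j n → 6 ≤ n → n ≤ 2 ℕ.+ j →
  consecutivePairs j n - shift 2 (consecutivePairs j) n ≡ count special? (2 ℕ.+ j) n
consecutivePairs-diff j n (s≤s (s≤s (s≤s (s≤s (s≤s (s≤s z≤n)))))) n≤2+j = begin
  D ≡⟨ ℤₚ.+-identityʳ D ⟨
  D + 0ℤ ≡⟨ cong (_+_ D) (shift-below (2 ℕ.+ j) _ (ℕₚ.≤-trans (ℕₚ.n≤1+n _) n≤2+j)) ⟨
  D + shift 2 (shift (2 ℕ.+ j) (shift (1 ℕ.+ j) (noOnes j))) n ≡⟨ consecutivePairs-telescope j n ⟩
  0ℤ + count special? (2 ℕ.+ j) n ≡⟨ ℤₚ.+-identityˡ _ ⟩
  count special? (2 ℕ.+ j) n ∎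
  where
  open ≡-Reasoning
  D = consecutivePairs j n - shift 2 (consecutivePairs j) n

proposition1p3 : (n : ℕ) → 6 ≤ n → s n ≡ + length (filter special? (strictParts n))
proposition1p3 _ (s≤s (s≤s (s≤s (s≤s (s≤s (s≤s {n = m} z≤n)))))) = begin
  s (6 ℕ.+ m)
    ≡⟨ s-via-noOnes (3 ℕ.+ m) ⟩
  (P (6 ℕ.+ m) - shift 1 P (6 ℕ.+ m)) - (P (4 ℕ.+ m) - shift 1 P (4 ℕ.+ m))
    ≡⟨ cong₂ _-_ (noOnes-diff j (6 ℕ.+ m) 3≤ ℕₚ.≤-refl) (noOnes-diff j (4 ℕ.+ m) 3≤ (ℕₚ.m≤n+m _ 2)) ⟩
  consecutivePairs j (6 ℕ.+ m) - shift 2 (consecutivePairs j) (6 ℕ.+ m)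
    ≡⟨ consecutivePairs-diff j (6 ℕ.+ m) (ℕₚ.m≤m+n 6 m) ℕₚ.≤-refl ⟩
  count special? (6 ℕ.+ m) (6 ℕ.+ m) ∎
  where
  open ≡-Reasoning
  j = 4 ℕ.+ m
  P = noOnes (6 ℕ.+ m)
  3≤ : ∀ {k} → 3 ≤ 3 ℕ.+ k
  3≤ = s≤s (s≤s (s≤s z≤n))
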